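{- There exists a function $f(a,b)$ such that for all integers $a,b\ge1$, every $a\times f(a,b)$-orchard $\mathsf{R}$ contains a tame $a\times b$-suborchard.
   Context: An $a\times b$-orchard in a graph $G$ consists of pairwise vertex-disjoint paths $P_1,\dots,P_a$ (horizontal paths) and pairwise vertex-disjoint trees $T_1,\dots,T_b$ (vertical trees) such that each $P_i\cap T_j$ is non-empty and connected (hence a path) and every leaf of each $T_j$ lies on some horizontal path. Since the subpaths $P_i\cap T_j$, $j\in[b]$, are disjoint, following $P_i$ from one end to the other meets the vertical trees in some order. The orchard is tame if there is a permutation $\pi$ of $[b]$ such that for every $i\in[a]$, following $P_i$ from one endpoint to the other one meets the vertical trees in the order $T_{\pi(1)},\dots,T_{\pi(b)}$ or in the reverse order. A suborchard is obtained by selecting a subset of the horizontal paths and a subset of the vertical trees. -}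

module Defs where

open import Level using (0ℓ)
open import Data.Nat using (ℕ)
open import Data.Fin using (Fin) renaming (_<_ to _<ᶠ_)
open import Data.Fin.Permutation using (Permutation′; _⟨$⟩ʳ_)
open import Data.List using (List; []; _∷_; _++_; length; lookup)
open import Data.List.Membership.Propositional using (_∈_; _∉_)
open import Data.List.Relation.Unary.Linked using (Linked)
open import Data.List.Relation.Unary.Unique.Propositional using (Unique)
open import Data.Product using (Σ; ∃; ∃-syntax; _×_; _,_)
open import Data.Sum using (_⊎_)
open import Data.Empty using (⊥)
open import Relation.Nullary using (¬_)
open import Relation.Binary.PropositionalEquality using (_≡_; _≢_)
open import Function.Definitions using (Injective)

record Graph : Set₁ where
  field
    n     : ℕ
    Adj   : Fin n → Fin n → Set
    sym   : ∀ {u v} → Adj u v → Adj v u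
    irr   : ∀ {u} → ¬ Adj u u

record Subgraph (G : Graph) : Set₁ where
  open Graph G
  field
    V     : Fin n → Set
    E     : Fin n → Fin n → Set
    E-sym : ∀ {u v} → E u v → E v u
    E-Adj : ∀ {u v} → E u v → Adj u v
    E-V   : ∀ {u v} → E u v → V u × V v

module _ {G : Graph} where
  open Graph G

  ConnectedRel : (Fin n → Set) → (Fin n → Fin n → Set) → Set
  ConnectedRel V E = ∀ u v → V u → V v →
    u ≡ v ⊎ ∃[ mid ] Linked E (u ∷ mid ++ v ∷ [])

  Connected : Subgraph G → Set
  Connected H = ConnectedRel (Subgraph.V H) (Subgraph.E H)

  Acyclic : Subgraph G → Set
  Acyclic H = ∀ x y z rest →
    Unique (x ∷ y ∷ rest ++ z ∷ []) →
    Linked (Subgraph.E H) (x ∷ y ∷ rest ++ z ∷ []) →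
    ¬ Subgraph.E H z x

  IsTree : Subgraph G → Set
  IsTree T = (∃[ v ] Subgraph.V T v) × Connected T × Acyclic T

  IsLeaf : Subgraph G → Fin n → Set
  IsLeaf T v = Subgraph.V T v ×
    (∀ u w → Subgraph.E T v u → Subgraph.E T v w → u ≡ w)

  IsPath : List (Fin n) → Set
  IsPath xs = (xs ≢ []) × Unique xs × Linked Adj xs

  PathEdge : List (Fin n) → Fin n → Fin n → Set
  PathEdge xs u v = ∃[ ys ] ∃[ zs ]
    (xs ≡ ys ++ u ∷ v ∷ zs ⊎ xs ≡ ys ++ v ∷ u ∷ zs)

  IntV : List (Fin n) → Subgraph G → Fin n → Set
  IntV xs T x = x ∈ xs × Subgraph.V T x

  IntE : List (Fin n) → Subgraph G → Fin n → Fin n → Set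
  IntE xs T x y = PathEdge xs x y × Subgraph.E T x y

  Before : List (Fin n) → Subgraph G → Subgraph G → Set
  Before xs T T' = ∃[ p ] ∃[ q ] (p <ᶠ q) ×
    Subgraph.V T (lookup xs p) × Subgraph.V T' (lookup xs q)

record OrchardData (G : Graph) (a b : ℕ) : Set₁ where
  field
    path : Fin a → List (Fin (Graph.n G))
    tree : Fin b → Subgraph G

module _ {G : Graph} {a b : ℕ} (R : OrchardData G a b) where
  open Graph G
  open OrchardData R

  IsOrchard : Set
  IsOrchard =
    (∀ i → IsPath {G} (path i)) ×
    (∀ i i' x → i ≢ i' → x ∈ path i → x ∉ path i') ×
    (∀ j → IsTree (tree j)) ×
    (∀ j j' x → j ≢ j' → Subgraph.V (tree j) x → ¬ Subgraph.V (tree j') x) ×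
    (∀ i j → ∃[ x ] IntV (path i) (tree j) x) ×
    (∀ i j → ConnectedRel {G} (IntV (path i) (tree j)) (IntE (path i) (tree j))) ×
    (∀ j v → IsLeaf (tree j) v → ∃[ i ] v ∈ path i)

  Tame : Set
  Tame = Σ (Permutation′ b) λ π → ∀ i →
    (∀ s t → s <ᶠ t → Before (path i) (tree (π ⟨$⟩ʳ s)) (tree (π ⟨$⟩ʳ t))) ⊎
    (∀ s t → s <ᶠ t → Before (path i) (tree (π ⟨$⟩ʳ t)) (tree (π ⟨$⟩ʳ s)))

restrict : ∀ {G a b a' b'} → OrchardData G a b →
  (Fin a' → Fin a) → (Fin b' → Fin b) → OrchardData G a' b'
restrict R ι κ = record
  { path = λ i → OrchardData.path R (ι i)
  ; tree = λ j → OrchardData.tree R (κ j) }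

-- For each horizontal path P_i pick a vertex of P_i ∩ T_j for every tree T_j; its position
-- along P_i is a key x_i(j), and distinct trees get distinct keys because the trees are
-- disjoint. Applying the Erdős–Szekeres theorem a times, once per path, leaves b trees on
-- which every key x_i is monotone, so each path meets these b trees in one common order
-- or its reverse.
module Submission where

open import Defs
open import Data.Nat using (ℕ; _≤_; zero; suc; _+_; _<_; _≤?_; z≤n; s≤s)
open import Data.Fin using (Fin)
open import Data.Product using (Σ; ∃-syntax; _×_; _,_)
open import Relation.Binary.PropositionalEquality using (_≡_)
open import Function.Definitions using (Injective)
open import Data.Nat.Properties
  using (≤-trans; ≤-reflexive; +-suc; +-mono-<; ≰⇒>; <⇒≱; ≤∧≢⇒<)
open import Data.Fin as Fin using (toℕ; inject≤) renaming (_<_ to _<ᶠ_)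
open import Data.Fin.Properties using (<-cmp; inject≤-injective; toℕ-inject≤; toℕ-injective)
import Data.Fin.Permutation as Permutation
open import Data.List using (List; []; _∷_; length; lookup; allFin)
open import Data.List.Properties using (length-tabulate)
open import Data.List.Membership.Propositional using (lose)
open import Data.List.Membership.Propositional.Properties using (∈-lookup)
open import Data.List.Relation.Binary.Sublist.Propositional
  using (_⊆_; []; _∷_; _∷ʳ_; minimum; ⊆-refl; ⊆-trans)
open import Data.List.Relation.Binary.Sublist.Propositional.Properties using (All-resp-⊆)
open import Data.List.Relation.Unary.All as All using (All; []; _∷_)
open import Data.List.Relation.Unary.AllPairs as AllPairs using (AllPairs; []; _∷_)
open import Data.List.Relation.Unary.Any as Any using (Any)
open import Data.List.Relation.Unary.Any.Properties using (lookup-index)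
open import Data.List.Relation.Unary.Unique.Propositional using (Unique)
open import Data.List.Relation.Unary.Unique.Propositional.Properties using (allFin⁺)
open import Data.Sum as Sum using (_⊎_; inj₁; inj₂)
open import Data.Empty using (⊥-elim)
open import Function using (id; _∘_)
open import Relation.Binary.Definitions using (tri<; tri≈; tri>)
open import Relation.Binary.PropositionalEquality using (_≢_; refl; sym; subst; subst₂)
open import Relation.Nullary using (¬_; yes; no)

module _ {A : Set} where

  AllPairs-resp-⊆ : ∀ {R : A → A → Set} {xs ys} → ys ⊆ xs → AllPairs R xs → AllPairs R ys
  AllPairs-resp-⊆ []         []         = []
  AllPairs-resp-⊆ (_ ∷ʳ τ)   (_ ∷ rxs)  = AllPairs-resp-⊆ τ rxs
  AllPairs-resp-⊆ (refl ∷ τ) (rx ∷ rxs) = All-resp-⊆ τ rx ∷ AllPairs-resp-⊆ τ rxs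

  AllPairs-lookup : ∀ {R : A → A → Set} {xs} → AllPairs R xs →
    ∀ {p q} → p <ᶠ q → R (lookup xs p) (lookup xs q)
  AllPairs-lookup (rx ∷ _)   {Fin.zero}  {Fin.suc q} _         = All.lookup rx (∈-lookup q)
  AllPairs-lookup (_ ∷ rxs)  {Fin.suc p} {Fin.suc q} (s≤s p<q) = AllPairs-lookup rxs p<q

  Unique-lookup-injective : ∀ {xs} → Unique xs → Injective _≡_ _≡_ (lookup xs)
  Unique-lookup-injective xs! {p} {q} eq with <-cmp p q
  ... | tri< p<q _ _ = ⊥-elim (AllPairs-lookup xs! p<q eq)
  ... | tri≈ _ p≡q _ = p≡q
  ... | tri> _ _ q<p = ⊥-elim (AllPairs-lookup xs! q<p (sym eq))

  firstEntries : ∀ {b} (ys : List A) → b ≤ length ys → Fin b → A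
  firstEntries ys b≤ s = lookup ys (inject≤ s b≤)

  AllPairs-firstEntries : ∀ {R : A → A → Set} {b ys} (b≤ : b ≤ length ys) → AllPairs R ys →
    ∀ {s t} → s <ᶠ t → R (firstEntries ys b≤ s) (firstEntries ys b≤ t)
  AllPairs-firstEntries b≤ rys {s} {t} s<t = AllPairs-lookup rys
    (subst₂ _<_ (sym (toℕ-inject≤ s b≤)) (sym (toℕ-inject≤ t b≤)) s<t)

  Unique-firstEntries-injective : ∀ {b ys} (b≤ : b ≤ length ys) → Unique ys →
    Injective _≡_ _≡_ (firstEntries ys b≤)
  Unique-firstEntries-injective b≤ ys! = inject≤-injective b≤ b≤ _ _ ∘ Unique-lookup-injective ys!

  HasSublist : (List A → Set) → ℕ → List A → Set
  HasSublist P n xs = ∃[ ys ] ys ⊆ xs × P ys × n ≤ length ys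

  HasSublist-⊆ : ∀ {P n xs ys} → ys ⊆ xs → HasSublist P n ys → HasSublist P n xs
  HasSublist-⊆ τ (zs , σ , pzs , n≤) = zs , ⊆-trans σ τ , pzs , n≤

  HasSublist-∷ : ∀ {R : A → A → Set} {n x xs} → All (R x) xs →
    HasSublist (AllPairs R) n xs → HasSublist (AllPairs R) (suc n) (x ∷ xs)
  HasSublist-∷ rx (ys , τ , rys , n≤) = _ ∷ ys , refl ∷ τ , All-resp-⊆ τ rx ∷ rys , s≤s n≤

erdősSzekeresBound : ℕ → ℕ → ℕ
erdősSzekeresBound zero    s       = 0
erdősSzekeresBound (suc r) zero    = 0
erdősSzekeresBound (suc r) (suc s) =
  suc (erdősSzekeresBound r (suc s) + erdősSzekeresBound (suc r) s)

module ErdősSzekeres {A : Set} (key : A → ℕ) where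

  Ascending Descending Monotone KeysDistinct : List A → Set
  Ascending    = AllPairs (λ u v → key u < key v)
  Descending   = AllPairs (λ u v → key v < key u)
  Monotone ys  = Ascending ys ⊎ Descending ys
  KeysDistinct = AllPairs (λ u v → key u ≢ key v)

  Monotone-resp-⊆ : ∀ {xs ys} → ys ⊆ xs → Monotone xs → Monotone ys
  Monotone-resp-⊆ τ = Sum.map (AllPairs-resp-⊆ τ) (AllPairs-resp-⊆ τ)

  partitionAround : ∀ x xs → All (λ y → key x ≢ key y) xs →
    ∃[ L ] ∃[ S ] L ⊆ xs × S ⊆ xs ×
      All (λ y → key x < key y) L × All (λ y → key y < key x) S ×
      length xs ≤ length L + length S
  partitionAround x []       []         = [] , [] , [] , [] , [] , [] , z≤n
  partitionAround x (y ∷ xs) (x≠y ∷ x≠) with partitionAround x xs x≠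
  ... | L , S , L⊆ , S⊆ , above , below , split with key x ≤? key y
  ... | yes x≤y = y ∷ L , S , refl ∷ L⊆ , y ∷ʳ S⊆ , ≤∧≢⇒< x≤y x≠y ∷ above , below , s≤s split
  ... | no x≰y  = L , y ∷ S , y ∷ʳ L⊆ , refl ∷ S⊆ , above , ≰⇒> x≰y ∷ below ,
                  ≤-trans (s≤s split) (≤-reflexive (sym (+-suc (length L) (length S))))

  erdős-szekeres : ∀ r s xs → KeysDistinct xs → erdősSzekeresBound r s ≤ length xs →
    HasSublist Ascending r xs ⊎ HasSublist Descending s xs
  erdős-szekeres zero    s       xs       _            _ = inj₁ ([] , minimum xs , [] , z≤n)
  erdős-szekeres (suc r) zero    xs       _            _ = inj₂ ([] , minimum xs , [] , z≤n)
  erdős-szekeres (suc r) (suc s) (x ∷ xs) (x≠ ∷ xs≠) (s≤s bound)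
    with partitionAround x xs x≠
  ... | L , S , L⊆ , S⊆ , above , below , split
    with erdősSzekeresBound r (suc s) ≤? length L | erdősSzekeresBound (suc r) s ≤? length S
  ... | yes longL | _ = Sum.map (HasSublist-⊆ (refl ∷ L⊆) ∘ HasSublist-∷ above)
                                (HasSublist-⊆ (x ∷ʳ L⊆))
                                (erdős-szekeres r (suc s) L (AllPairs-resp-⊆ L⊆ xs≠) longL)
  ... | no _ | yes longS = Sum.map (HasSublist-⊆ (x ∷ʳ S⊆))
                                   (HasSublist-⊆ (refl ∷ S⊆) ∘ HasSublist-∷ below)
                                   (erdős-szekeres (suc r) s S (AllPairs-resp-⊆ S⊆ xs≠) longS)
  ... | no shortL | no shortS =
    ⊥-elim (<⇒≱ (+-mono-< (≰⇒> shortL) (≰⇒> shortS)) (≤-trans bound split))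

  monotone-sublist : ∀ n xs → KeysDistinct xs → erdősSzekeresBound n n ≤ length xs →
    HasSublist Monotone n xs
  monotone-sublist n xs xs≠ bound with erdős-szekeres n n xs xs≠ bound
  ... | inj₁ (ys , τ , asc , n≤)  = ys , τ , inj₁ asc , n≤
  ... | inj₂ (ys , τ , desc , n≤) = ys , τ , inj₂ desc , n≤

open ErdősSzekeres using (Monotone; KeysDistinct; Monotone-resp-⊆; monotone-sublist)

erdősSzekeresTower : ℕ → ℕ → ℕ
erdősSzekeresTower b zero    = b
erdősSzekeresTower b (suc m) = erdősSzekeresBound (erdősSzekeresTower b m) (erdősSzekeresTower b m)

simultaneously-monotone-sublist : ∀ {A : Set} {m} (key : Fin m → A → ℕ) b xs →
  (∀ k → KeysDistinct (key k) xs) → erdősSzekeresTower b m ≤ length xs →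
  HasSublist (λ ys → ∀ k → Monotone (key k) ys) b xs
simultaneously-monotone-sublist {m = zero} key b xs _ bound = xs , ⊆-refl , (λ ()) , bound
simultaneously-monotone-sublist {m = suc m} key b xs xs≠ bound =
  let (ys , ys⊆xs , mono₀ , longYs) =
        monotone-sublist (key Fin.zero) (erdősSzekeresTower b m) xs (xs≠ Fin.zero) bound
      (zs , zs⊆ys , mono , longZs) =
        simultaneously-monotone-sublist (key ∘ Fin.suc) b ys
          (λ k → AllPairs-resp-⊆ ys⊆xs (xs≠ (Fin.suc k))) longYs
  in zs , ⊆-trans zs⊆ys ys⊆xs ,
     (λ { Fin.zero → Monotone-resp-⊆ (key Fin.zero) zs⊆ys mono₀ ; (Fin.suc k) → mono k }) ,
     longZs

module Crossings {G : Graph} {a N : ℕ} (R : OrchardData G a N)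
  (meets : ∀ i j → ∃[ x ] IntV (OrchardData.path R i) (OrchardData.tree R j) x) where
  open OrchardData R

  crossing : ∀ i j → Any (Subgraph.V (tree j)) (path i)
  crossing i j = let (x , x∈P , x∈T) = meets i j in lose x∈P x∈T

  crossingPosition : ∀ i → Fin N → Fin (length (path i))
  crossingPosition i j = Any.index (crossing i j)

  crossingPosition-∈ : ∀ i j → Subgraph.V (tree j) (lookup (path i) (crossingPosition i j))
  crossingPosition-∈ i j = lookup-index (crossing i j)

  crossingKey : Fin a → Fin N → ℕ
  crossingKey i = toℕ ∘ crossingPosition i

  crossingKey-distinct : (∀ j j' x → j ≢ j' → Subgraph.V (tree j) x → ¬ Subgraph.V (tree j') x) →
    ∀ i {j j'} → j ≢ j' → crossingKey i j ≢ crossingKey i j'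
  crossingKey-distinct disjoint i {j} {j'} j≢j' eq = disjoint j j' _ j≢j' (crossingPosition-∈ i j)
    (subst (λ p → Subgraph.V (tree j') (lookup (path i) p)) (sym (toℕ-injective eq))
           (crossingPosition-∈ i j'))

  tame-if-crossings-monotone : ∀ {b} (κ : Fin b → Fin N) →
    (∀ i → (∀ {s t} → s <ᶠ t → crossingKey i (κ s) < crossingKey i (κ t))
         ⊎ (∀ {s t} → s <ᶠ t → crossingKey i (κ t) < crossingKey i (κ s))) →
    Tame (restrict R id κ)
  tame-if-crossings-monotone κ monotone = Permutation.id , λ i → Sum.map
    (λ asc s t s<t → _ , _ , asc s<t , crossingPosition-∈ i (κ s) , crossingPosition-∈ i (κ t))
    (λ desc s t s<t → _ , _ , desc s<t , crossingPosition-∈ i (κ t) , crossingPosition-∈ i (κ s))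
    (monotone i)

tame-suborchard : ∀ {G a} b (R : OrchardData G a (erdősSzekeresTower b a)) → IsOrchard R →
  Σ (Fin b → Fin (erdősSzekeresTower b a)) λ κ → Injective _≡_ _≡_ κ × Tame (restrict R id κ)
tame-suborchard {a = a} b R (_ , _ , _ , disjoint , meets , _ , _) =
  let (ys , ys⊆ , mono , long) = simultaneously-monotone-sublist crossingKey b (allFin N)
        (λ i → AllPairs.map (crossingKey-distinct disjoint i) (allFin⁺ N))
        (≤-reflexive (sym (length-tabulate id)))
  in firstEntries ys long ,
     Unique-firstEntries-injective long (AllPairs-resp-⊆ ys⊆ (allFin⁺ N)) ,
     tame-if-crossings-monotone (firstEntries ys long)
       (λ i → Sum.map (AllPairs-firstEntries long) (AllPairs-firstEntries long) (mono i))
  where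
  N = erdősSzekeresTower b a
  open Crossings R meets

lemma6p3 : Σ (ℕ → ℕ → ℕ) λ f → (∀ (a b : ℕ) → 1 ≤ a → 1 ≤ b →
    ∀ (G : Graph) (R : OrchardData G a (f a b)) → IsOrchard R →
    Σ (Fin a → Fin a) λ ι → Σ (Fin b → Fin (f a b)) λ κ → (Injective _≡_ _≡_ ι × Injective _≡_ _≡_ κ ×
    Tame (restrict {a' = a} {b' = b} R ι κ)))
lemma6p3 = (λ a b → erdősSzekeresTower b a) , λ a b _ _ G R orchard →
  let (κ , κ-injective , tame) = tame-suborchard b R orchard
  in id , κ , id , κ-injective , tame
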